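{- Let $G=(V,E)$ be a simple connected graph with $n=|V|$, and let $\{V_1,V_2,V_3,V_4\}$ be a feasible tetrapartition of $V$ with $|V_1|\le|V_2|\le|V_3|\le|V_4|$ and $|V_4|>\frac25 n$. Let $i,j\in\{1,2,3\}$ be distinct with $V_i$ and $V_j$ adjacent and $|V_i|+|V_j|<|V_4|$, let $h=6-i-j$, and let $\{V_{41},V_{42}\}$ be any feasible bipartition of $V_4$. Then $\{V_i\cup V_j,V_h,V_{41},V_{42}\}$ is a feasible tetrapartition of $V$ and it is better than $\{V_1,V_2,V_3,V_4\}$.
   Context: A feasible $k$-partition of a vertex set is a partition into $k$ non-empty parts each inducing a connected subgraph of $G$; tetrapartition means $k=4$, bipartition $k=2$. Two disjoint vertex sets are adjacent if some edge joins them. For feasible $k$-partitions $\{V_1,\dots,V_k\}$ and $\{V'_1,\dots,V'_k\}$, each labelled so that part sizes are non-decreasing, $\{V'_i\}$ is better than $\{V_i\}$ if $|V'_k|<|V_k|$, or $|V'_k|=|V_k|$ and $|V'_{k-1}|<|V_{k-1}|$. -}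

module Defs where

open import Data.Nat using (ℕ; zero; suc; _≤_; _<_)
open import Data.Fin using (Fin; zero; suc; fromℕ; inject₁)
open import Data.Fin.Subset using (Subset; _∈_; ∣_∣; Nonempty; ⊤)
open import Data.Fin.Permutation using (Permutation′; _⟨$⟩ʳ_)
open import Data.Product using (Σ; ∃; _×_)
open import Data.Sum using (_⊎_)
open import Data.Empty using (⊥)
open import Relation.Nullary using (¬_)
open import Relation.Binary.PropositionalEquality using (_≡_)

record Graph (n : ℕ) : Set₁ where
  field
    Adj     : Fin n → Fin n → Set
    sym     : ∀ {u v} → Adj u v → Adj v u
    irrefl  : ∀ {u} → ¬ Adj u u
open Graph public

module _ {n : ℕ} (G : Graph n) where

  data WalkIn (S : Subset n) : Fin n → Fin n → Set where
    here : ∀ {u} → u ∈ S → WalkIn S u u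
    step : ∀ {u w v} → u ∈ S → Adj G u w → WalkIn S w v → WalkIn S u v

  InducesConnected : Subset n → Set
  InducesConnected S = ∀ u v → u ∈ S → v ∈ S → WalkIn S u v

  ConnectedGraph : Set
  ConnectedGraph = InducesConnected ⊤

  AdjacentSets : Subset n → Subset n → Set
  AdjacentSets A B = Σ (Fin n) λ u → Σ (Fin n) λ v → u ∈ A × v ∈ B × Adj G u v

  FeasiblePartitionOf : (k : ℕ) → Subset n → (Fin k → Subset n) → Set
  FeasiblePartitionOf k S P =
    (∀ a → Nonempty (P a)) ×
    (∀ a b → ¬ a ≡ b → ∀ v → v ∈ P a → v ∈ P b → ⊥) ×
    (∀ v → v ∈ S → ∃ λ a → v ∈ P a) ×
    (∀ a v → v ∈ P a → v ∈ S) ×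
    (∀ a → InducesConnected (P a))

SortedBy : ∀ {n k} → (Fin k → Subset n) → Permutation′ k → Set
SortedBy {k = k} P σ = ∀ (a b : Fin k) → Data.Fin._≤_ a b →
  ∣ P (σ ⟨$⟩ʳ a) ∣ ≤ ∣ P (σ ⟨$⟩ʳ b) ∣
  where import Data.Fin

Better : ∀ {n m} → (P' P : Fin (suc (suc m)) → Subset n) → Set
Better {m = m} P' P = ∀ (σ' σ : Permutation′ (suc (suc m))) →
  SortedBy P' σ' → SortedBy P σ →
  (∣ P' (σ' ⟨$⟩ʳ lst) ∣ < ∣ P (σ ⟨$⟩ʳ lst) ∣) ⊎
  (∣ P' (σ' ⟨$⟩ʳ lst) ∣ ≡ ∣ P (σ ⟨$⟩ʳ lst) ∣ ×
   ∣ P' (σ' ⟨$⟩ʳ snd) ∣ < ∣ P (σ ⟨$⟩ʳ snd) ∣)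
  where
    lst : Fin (suc (suc m))
    lst = fromℕ (suc m)
    snd : Fin (suc (suc m))
    snd = inject₁ (fromℕ m)

module Submission where

-- Parts are indexed from 0 here.  The new partition Q = {V_i ∪ V_j, V_h, W₀, W₁} is
-- feasible: V_i ∪ V_j is connected because the union of two adjacent connected
-- sets is connected, and the other partition axioms are bookkeeping about which
-- old part each vertex came from.  Q is better than V by a general criterion
-- (better-criterion): if one new part c is no larger than some old part x, and
-- every other new part is strictly smaller than a different old part y, the new
-- partition is better.  Here c = V_h, x = V₂, y = V₃: V_i ∪ V_j has at most
-- |V_i| + |V_j| < |V₃| vertices and each W_k is a proper subset of V₃.

open import Defs hiding (sym)
open import Data.Nat using (ℕ; zero; suc; _+_; _*_; _≤_; _<_; z≤n; s≤s)
open import Data.Nat.Properties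
  using (≤-refl; ≤-reflexive; ≤-trans; <-≤-trans; ≤-<-trans; +-suc; n≤1+n; m≤n⇒m<n∨m≡n)
open import Data.Fin using (Fin; zero; suc; toℕ; inject₁; fromℕ; _≟_)
open import Data.Fin.Properties using (≤fromℕ; ≤∧≢⇒<; fromℕ≢inject₁; inject₁-injective; toℕ-inject₁)
open import Data.Fin.Subset using (Subset; _∪_; ∣_∣; ⊤; _∈_; _⊆_; inside; outside; Nonempty)
open import Data.Fin.Subset.Properties using (p⊂q⇒∣p∣<∣q∣; x∈p∪q⁻; p⊆p∪q; q⊆p∪q; ∈⊤)
open import Data.Fin.Permutation using (Permutation′; _⟨$⟩ʳ_; _⟨$⟩ˡ_; inverseʳ; inverseˡ)
open import Data.Vec using (_∷_; []; lookup)
open import Data.Product using (_×_; _,_; ∃; proj₁; proj₂)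
open import Data.Sum using (_⊎_; inj₁; inj₂)
open import Data.Empty using (⊥)
open import Function using (_∘_)
open import Relation.Nullary using (¬_; Dec; yes; no; contradiction)
open import Relation.Binary.PropositionalEquality using (_≡_; _≢_; refl; sym; trans; cong; subst; module ≡-Reasoning)

private
  variable
    n : ℕ

∣p∪q∣≤∣p∣+∣q∣ : (p q : Subset n) → ∣ p ∪ q ∣ ≤ ∣ p ∣ + ∣ q ∣
∣p∪q∣≤∣p∣+∣q∣ [] [] = z≤n
∣p∪q∣≤∣p∣+∣q∣ (outside ∷ p) (outside ∷ q) = ∣p∪q∣≤∣p∣+∣q∣ p q
∣p∪q∣≤∣p∣+∣q∣ (outside ∷ p) (inside ∷ q) =
  ≤-trans (s≤s (∣p∪q∣≤∣p∣+∣q∣ p q)) (≤-reflexive (sym (+-suc ∣ p ∣ ∣ q ∣)))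
∣p∪q∣≤∣p∣+∣q∣ (inside ∷ p) (outside ∷ q) = s≤s (∣p∪q∣≤∣p∣+∣q∣ p q)
∣p∪q∣≤∣p∣+∣q∣ (inside ∷ p) (inside ∷ q) =
  s≤s (≤-trans (∣p∪q∣≤∣p∣+∣q∣ p q) (≤-trans (n≤1+n _) (≤-reflexive (sym (+-suc ∣ p ∣ ∣ q ∣)))))

Disjoint : Subset n → Subset n → Set
Disjoint A B = ∀ v → v ∈ A → v ∈ B → ⊥

disjoint-sym : {A B : Subset n} → Disjoint A B → Disjoint B A
disjoint-sym A∩B=∅ v v∈B v∈A = A∩B=∅ v v∈A v∈B

disjoint-⊆ʳ : {A B B′ : Subset n} → B ⊆ B′ → Disjoint A B′ → Disjoint A B
disjoint-⊆ʳ B⊆B′ A∩B′=∅ v v∈A v∈B = A∩B′=∅ v v∈A (B⊆B′ v∈B)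

disjoint-∪ˡ : {A B C : Subset n} → Disjoint A C → Disjoint B C → Disjoint (A ∪ B) C
disjoint-∪ˡ {A = A} {B} A∩C=∅ B∩C=∅ v v∈A∪B v∈C with x∈p∪q⁻ A B v∈A∪B
... | inj₁ v∈A = A∩C=∅ v v∈A v∈C
... | inj₂ v∈B = B∩C=∅ v v∈B v∈C

module Feasible {n k : ℕ} {G : Graph n} {S : Subset n} {P : Fin k → Subset n}
                (feasible : FeasiblePartitionOf G k S P) where

  nonempty : ∀ a → Nonempty (P a)
  nonempty = proj₁ feasible

  disjoint : ∀ a b → a ≢ b → Disjoint (P a) (P b)
  disjoint = proj₁ (proj₂ feasible)

  cover : ∀ v → v ∈ S → ∃ λ a → v ∈ P a
  cover = proj₁ (proj₂ (proj₂ feasible))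

  within : ∀ a → P a ⊆ S
  within a {v} = proj₁ (proj₂ (proj₂ (proj₂ feasible))) a v

  connected : ∀ a → InducesConnected G (P a)
  connected = proj₂ (proj₂ (proj₂ (proj₂ feasible)))

-- Every part of a feasible partition into at least two parts is strictly smaller
-- than the partitioned set: any vertex of another part is missing from it.
part-smaller : {G : Graph n} {k : ℕ} {S : Subset n} {P : Fin k → Subset n} →
  FeasiblePartitionOf G k S P → ∀ a b → a ≢ b → ∣ P a ∣ < ∣ S ∣
part-smaller feasible a b a≢b with Feasible.nonempty feasible b
... | v , v∈Pb =
  p⊂q⇒∣p∣<∣q∣ (within a , v , within b v∈Pb , λ v∈Pa → disjoint a b a≢b v v∈Pa v∈Pb)
  where open Feasible feasible

module Walks {n : ℕ} (G : Graph n) where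

  walk-mono : {S T : Subset n} → S ⊆ T → ∀ {u v} → WalkIn G S u v → WalkIn G T u v
  walk-mono S⊆T (here u∈S) = here (S⊆T u∈S)
  walk-mono S⊆T (step u∈S edge rest) = step (S⊆T u∈S) edge (walk-mono S⊆T rest)

  _++_ : {S : Subset n} {u v w : Fin n} → WalkIn G S u v → WalkIn G S v w → WalkIn G S u w
  here _ ++ rest = rest
  step u∈S edge first ++ rest = step u∈S edge (first ++ rest)

  -- The union of two adjacent connected sets is connected: every vertex of A ∪ B
  -- reaches (and is reached from) the endpoint x ∈ A of a joining edge xy.
  union-connected : (A B : Subset n) → InducesConnected G A → InducesConnected G B →
    AdjacentSets G A B → InducesConnected G (A ∪ B)
  union-connected A B A-conn B-conn (x , y , x∈A , y∈B , xy) u v u∈A∪B v∈A∪B = to-x ++ from-x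
    where
      inA : A ⊆ A ∪ B
      inA = p⊆p∪q B
      inB : B ⊆ A ∪ B
      inB = q⊆p∪q A B
      to-x : WalkIn G (A ∪ B) u x
      to-x with x∈p∪q⁻ A B u∈A∪B
      ... | inj₁ u∈A = walk-mono inA (A-conn u x u∈A x∈A)
      ... | inj₂ u∈B =
        walk-mono inB (B-conn u y u∈B y∈B) ++ step (inB y∈B) (Graph.sym G xy) (here (inA x∈A))
      from-x : WalkIn G (A ∪ B) x v
      from-x with x∈p∪q⁻ A B v∈A∪B
      ... | inj₁ v∈A = walk-mono inA (A-conn x v x∈A v∈A)
      ... | inj₂ v∈B = step (inA x∈A) xy (walk-mono inB (B-conn y v y∈B v∈B))

last : (m : ℕ) → Fin (suc (suc m))
last m = fromℕ (suc m)

second-last : (m : ℕ) → Fin (suc (suc m))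
second-last m = inject₁ (fromℕ m)

≤second-last : {m : ℕ} (r : Fin (suc (suc m))) → r ≢ last m → toℕ r ≤ toℕ (second-last m)
≤second-last {m} r r≢last with ≤∧≢⇒< (≤fromℕ r) r≢last
... | s≤s r≤m = ≤-trans r≤m (≤-reflexive (sym (toℕ-inject₁ (fromℕ m))))

permute-injective : {k : ℕ} (σ : Permutation′ k) {a b : Fin k} → σ ⟨$⟩ʳ a ≡ σ ⟨$⟩ʳ b → a ≡ b
permute-injective σ {a} {b} eq = begin
  a                   ≡⟨ sym (inverseˡ σ) ⟩
  σ ⟨$⟩ˡ (σ ⟨$⟩ʳ a)   ≡⟨ cong (σ ⟨$⟩ˡ_) eq ⟩
  σ ⟨$⟩ˡ (σ ⟨$⟩ʳ b)   ≡⟨ inverseˡ σ ⟩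
  b                   ∎
  where open ≡-Reasoning

unpermute-injective : {k : ℕ} (σ : Permutation′ k) {a b : Fin k} → σ ⟨$⟩ˡ a ≡ σ ⟨$⟩ˡ b → a ≡ b
unpermute-injective σ {a} {b} eq = begin
  a                   ≡⟨ sym (inverseʳ σ) ⟩
  σ ⟨$⟩ʳ (σ ⟨$⟩ˡ a)   ≡⟨ cong (σ ⟨$⟩ʳ_) eq ⟩
  σ ⟨$⟩ʳ (σ ⟨$⟩ˡ b)   ≡⟨ inverseʳ σ ⟩
  b                   ∎
  where open ≡-Reasoning

module Sorted {n m : ℕ} (P : Fin (suc (suc m)) → Subset n) (σ : Permutation′ (suc (suc m)))
              (sorted : SortedBy P σ) where

  below-position : ∀ a r → toℕ (σ ⟨$⟩ˡ a) ≤ toℕ r → ∣ P a ∣ ≤ ∣ P (σ ⟨$⟩ʳ r) ∣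
  below-position a r a≤r =
    subst (λ b → ∣ P b ∣ ≤ ∣ P (σ ⟨$⟩ʳ r) ∣) (inverseʳ σ) (sorted (σ ⟨$⟩ˡ a) r a≤r)

  largest : ∀ a → ∣ P a ∣ ≤ ∣ P (σ ⟨$⟩ʳ last m) ∣
  largest a = below-position a (last m) (≤fromℕ (σ ⟨$⟩ˡ a))

  second-largest : ∀ a b → a ≢ b → ∀ s → s ≤ ∣ P a ∣ → s ≤ ∣ P b ∣ →
    s ≤ ∣ P (σ ⟨$⟩ʳ second-last m) ∣
  second-largest a b a≢b s s≤a s≤b with σ ⟨$⟩ˡ a ≟ last m
  ... | no  a≢last = ≤-trans s≤a (below-position a (second-last m) (≤second-last _ a≢last))
  ... | yes a-last = ≤-trans s≤b (below-position b (second-last m) (≤second-last _ b≢last))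
    where
      b≢last : σ ⟨$⟩ˡ b ≢ last m
      b≢last b-last = a≢b (unpermute-injective σ (trans a-last (sym b-last)))

-- A sufficient condition for Q to be better than P: some part c of Q is no larger
-- than a part x of P, and all other parts of Q are strictly smaller than a part
-- y ≠ x of P.  Then either Q's largest part is already smaller than P's, or it is
-- c and has the size of P's largest part; in that case both x and y are at least
-- |P y|, so P's second largest part is at least |P y|, which exceeds Q's second.
better-criterion : {n m : ℕ} (Q P : Fin (suc (suc m)) → Subset n) (c x y : Fin (suc (suc m))) →
  x ≢ y → ∣ Q c ∣ ≤ ∣ P x ∣ → (∀ d → d ≢ c → ∣ Q d ∣ < ∣ P y ∣) → Better Q P
better-criterion {m = m} Q P c x y x≢y c≤x others<y τ σ _ sorted = by-top (top ≟ c)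
  where
    open Sorted P σ sorted
    top second : Fin (suc (suc m))
    top = τ ⟨$⟩ʳ last m
    second = τ ⟨$⟩ʳ second-last m

    second≢c : top ≡ c → second ≢ c
    second≢c top≡c second≡c =
      fromℕ≢inject₁ (sym (permute-injective τ (trans second≡c (sym top≡c))))

    top≤x : top ≡ c → ∣ Q top ∣ ≤ ∣ P x ∣
    top≤x top≡c = subst (λ d → ∣ Q d ∣ ≤ ∣ P x ∣) (sym top≡c) c≤x

    by-top : Dec (top ≡ c) →
      (∣ Q top ∣ < ∣ P (σ ⟨$⟩ʳ last m) ∣) ⊎
      (∣ Q top ∣ ≡ ∣ P (σ ⟨$⟩ʳ last m) ∣ × ∣ Q second ∣ < ∣ P (σ ⟨$⟩ʳ second-last m) ∣)
    by-top (no top≢c) = inj₁ (<-≤-trans (others<y top top≢c) (largest y))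
    by-top (yes top≡c) with m≤n⇒m<n∨m≡n (≤-trans (top≤x top≡c) (largest x))
    ... | inj₁ top<top = inj₁ top<top
    ... | inj₂ top≡top = inj₂ (top≡top , <-≤-trans (others<y second (second≢c top≡c)) second≥y)
      where
        y≤x : ∣ P y ∣ ≤ ∣ P x ∣
        y≤x = ≤-trans (largest y) (≤-trans (≤-reflexive (sym top≡top)) (top≤x top≡c))
        second≥y : ∣ P y ∣ ≤ ∣ P (σ ⟨$⟩ʳ second-last m) ∣
        second≥y = second-largest x y x≢y ∣ P y ∣ y≤x ≤-refl

inject₁-or-fromℕ : (a : Fin (suc n)) → (∃ λ x → a ≡ inject₁ x) ⊎ a ≡ fromℕ n
inject₁-or-fromℕ {zero} zero = inj₂ refl
inject₁-or-fromℕ {suc n} zero = inj₁ (zero , refl)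
inject₁-or-fromℕ {suc n} (suc a) with inject₁-or-fromℕ a
... | inj₁ (x , refl) = inj₁ (suc x , refl)
... | inj₂ refl = inj₂ refl

record Enumerates (i j h : Fin 3) : Set where
  constructor ordering
  field
    h≢i : h ≢ i
    h≢j : h ≢ j
    exhaust : ∀ x → x ≡ i ⊎ x ≡ j ⊎ x ≡ h

-- The hypotheses i ≢ j and i + j + h = 3 (i.e. h = 6 − i − j for indices counted
-- from one) force (i, j, h) to be an ordering of Fin 3.
enumerates : (i j h : Fin 3) → i ≢ j → toℕ i + toℕ j + toℕ h ≡ 3 → Enumerates i j h
enumerates zero zero _ i≢j _ = contradiction refl i≢j
enumerates (suc zero) (suc zero) _ i≢j _ = contradiction refl i≢j
enumerates (suc (suc zero)) (suc (suc zero)) _ i≢j _ = contradiction refl i≢j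
enumerates zero (suc zero) (suc (suc zero)) _ _ = ordering (λ ()) (λ ())
  λ { zero → inj₁ refl ; (suc zero) → inj₂ (inj₁ refl) ; (suc (suc zero)) → inj₂ (inj₂ refl) }
enumerates zero (suc (suc zero)) (suc zero) _ _ = ordering (λ ()) (λ ())
  λ { zero → inj₁ refl ; (suc zero) → inj₂ (inj₂ refl) ; (suc (suc zero)) → inj₂ (inj₁ refl) }
enumerates (suc zero) zero (suc (suc zero)) _ _ = ordering (λ ()) (λ ())
  λ { zero → inj₂ (inj₁ refl) ; (suc zero) → inj₁ refl ; (suc (suc zero)) → inj₂ (inj₂ refl) }
enumerates (suc zero) (suc (suc zero)) zero _ _ = ordering (λ ()) (λ ())
  λ { zero → inj₂ (inj₂ refl) ; (suc zero) → inj₁ refl ; (suc (suc zero)) → inj₂ (inj₁ refl) }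
enumerates (suc (suc zero)) zero (suc zero) _ _ = ordering (λ ()) (λ ())
  λ { zero → inj₂ (inj₁ refl) ; (suc zero) → inj₂ (inj₂ refl) ; (suc (suc zero)) → inj₁ refl }
enumerates (suc (suc zero)) (suc zero) zero _ _ = ordering (λ ()) (λ ())
  λ { zero → inj₂ (inj₂ refl) ; (suc zero) → inj₂ (inj₁ refl) ; (suc (suc zero)) → inj₁ refl }
enumerates zero (suc zero) zero _ ()
enumerates zero (suc zero) (suc zero) _ ()
enumerates zero (suc (suc zero)) zero _ ()
enumerates zero (suc (suc zero)) (suc (suc zero)) _ ()
enumerates (suc zero) zero zero _ ()
enumerates (suc zero) zero (suc zero) _ ()
enumerates (suc zero) (suc (suc zero)) (suc zero) _ ()
enumerates (suc zero) (suc (suc zero)) (suc (suc zero)) _ ()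
enumerates (suc (suc zero)) zero zero _ ()
enumerates (suc (suc zero)) zero (suc (suc zero)) _ ()
enumerates (suc (suc zero)) (suc zero) (suc zero) _ ()
enumerates (suc (suc zero)) (suc zero) (suc (suc zero)) _ ()

module MergeAndSplit {n : ℕ} (G : Graph n)
  (V : Fin 4 → Subset n) (V-feasible : FeasiblePartitionOf G 4 ⊤ V)
  (i j h : Fin 3) (ijh : Enumerates i j h) (adjacent : AdjacentSets G (V (inject₁ i)) (V (inject₁ j)))
  (W : Fin 2 → Subset n)
  (W-feasible : FeasiblePartitionOf G 2 (V (fromℕ 3)) W) where

  open Enumerates ijh
  open Walks G
  module V = Feasible V-feasible
  module W = Feasible W-feasible

  Merged : Fin 4 → Subset n
  Merged = lookup (V (inject₁ i) ∪ V (inject₁ j) ∷ V (inject₁ h) ∷ W zero ∷ W (suc zero) ∷ [])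

  private
    Vi Vj Vh : Subset n
    Vi = V (inject₁ i)
    Vj = V (inject₁ j)
    Vh = V (inject₁ h)

    ≢last : ∀ x → inject₁ x ≢ fromℕ 3
    ≢last x = fromℕ≢inject₁ ∘ sym

    merged-h : Disjoint (Vi ∪ Vj) Vh
    merged-h = disjoint-∪ˡ (V.disjoint _ _ (h≢i ∘ sym ∘ inject₁-injective))
                           (V.disjoint _ _ (h≢j ∘ sym ∘ inject₁-injective))

    merged-W : ∀ k → Disjoint (Vi ∪ Vj) (W k)
    merged-W k = disjoint-⊆ʳ (W.within k)
      (disjoint-∪ˡ (V.disjoint _ _ (≢last i)) (V.disjoint _ _ (≢last j)))

    h-W : ∀ k → Disjoint Vh (W k)
    h-W k = disjoint-⊆ʳ (W.within k) (V.disjoint _ _ (≢last h))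

    W₀-W₁ : Disjoint (W zero) (W (suc zero))
    W₀-W₁ = W.disjoint zero (suc zero) (λ ())

  disjoint : ∀ a b → a ≢ b → Disjoint (Merged a) (Merged b)
  disjoint zero zero a≢b = contradiction refl a≢b
  disjoint zero (suc zero) _ = merged-h
  disjoint zero (suc (suc zero)) _ = merged-W zero
  disjoint zero (suc (suc (suc zero))) _ = merged-W (suc zero)
  disjoint (suc zero) zero _ = disjoint-sym merged-h
  disjoint (suc zero) (suc zero) a≢b = contradiction refl a≢b
  disjoint (suc zero) (suc (suc zero)) _ = h-W zero
  disjoint (suc zero) (suc (suc (suc zero))) _ = h-W (suc zero)
  disjoint (suc (suc zero)) zero _ = disjoint-sym (merged-W zero)
  disjoint (suc (suc zero)) (suc zero) _ = disjoint-sym (h-W zero)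
  disjoint (suc (suc zero)) (suc (suc zero)) a≢b = contradiction refl a≢b
  disjoint (suc (suc zero)) (suc (suc (suc zero))) _ = W₀-W₁
  disjoint (suc (suc (suc zero))) zero _ = disjoint-sym (merged-W (suc zero))
  disjoint (suc (suc (suc zero))) (suc zero) _ = disjoint-sym (h-W (suc zero))
  disjoint (suc (suc (suc zero))) (suc (suc zero)) _ = disjoint-sym W₀-W₁
  disjoint (suc (suc (suc zero))) (suc (suc (suc zero))) a≢b = contradiction refl a≢b

  nonempty : ∀ a → Nonempty (Merged a)
  nonempty zero with V.nonempty (inject₁ i)
  ... | v , v∈Vi = v , p⊆p∪q Vj v∈Vi
  nonempty (suc zero) = V.nonempty (inject₁ h)
  nonempty (suc (suc zero)) = W.nonempty zero
  nonempty (suc (suc (suc zero))) = W.nonempty (suc zero)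

  covers : ∀ v → v ∈ ⊤ → ∃ λ c → v ∈ Merged c
  covers v _ with V.cover v ∈⊤
  ... | a , v∈Va with inject₁-or-fromℕ a
  ... | inj₂ refl with W.cover v v∈Va
  ...   | zero , v∈W₀ = suc (suc zero) , v∈W₀
  ...   | suc zero , v∈W₁ = suc (suc (suc zero)) , v∈W₁
  covers v _ | a , v∈Va | inj₁ (x , refl) with exhaust x
  ...   | inj₁ refl = zero , p⊆p∪q Vj v∈Va
  ...   | inj₂ (inj₁ refl) = zero , q⊆p∪q Vi Vj v∈Va
  ...   | inj₂ (inj₂ refl) = suc zero , v∈Va

  connected : ∀ a → InducesConnected G (Merged a)
  connected zero = union-connected Vi Vj (V.connected (inject₁ i)) (V.connected (inject₁ j)) adjacent
  connected (suc zero) = V.connected (inject₁ h)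
  connected (suc (suc zero)) = W.connected zero
  connected (suc (suc (suc zero))) = W.connected (suc zero)

  feasible : FeasiblePartitionOf G 4 ⊤ Merged
  feasible = nonempty , disjoint , covers , (λ _ _ _ → ∈⊤) , connected

  smaller-than-V₃ : ∣ Vi ∣ + ∣ Vj ∣ < ∣ V (fromℕ 3) ∣ →
    ∀ c → c ≢ suc zero → ∣ Merged c ∣ < ∣ V (fromℕ 3) ∣
  smaller-than-V₃ small zero _ = ≤-<-trans (∣p∪q∣≤∣p∣+∣q∣ Vi Vj) small
  smaller-than-V₃ _ (suc zero) c≢1 = contradiction refl c≢1
  smaller-than-V₃ _ (suc (suc zero)) _ = part-smaller W-feasible zero (suc zero) (λ ())
  smaller-than-V₃ _ (suc (suc (suc zero))) _ = part-smaller W-feasible (suc zero) zero (λ ())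

lemma5 : ∀ {n : ℕ} (G : Graph n) → ConnectedGraph G →
    (V : Fin 4 → Subset n) → FeasiblePartitionOf G 4 ⊤ V →
    ∣ V zero ∣ ≤ ∣ V (suc zero) ∣ →
    ∣ V (suc zero) ∣ ≤ ∣ V (suc (suc zero)) ∣ →
    ∣ V (suc (suc zero)) ∣ ≤ ∣ V (suc (suc (suc zero))) ∣ →
    2 * n < 5 * ∣ V (suc (suc (suc zero))) ∣ →
    (i j h : Fin 3) → ¬ i ≡ j → toℕ i + toℕ j + toℕ h ≡ 3 →
    AdjacentSets G (V (inject₁ i)) (V (inject₁ j)) →
    ∣ V (inject₁ i) ∣ + ∣ V (inject₁ j) ∣ < ∣ V (suc (suc (suc zero))) ∣ →
    (W : Fin 2 → Subset n) → FeasiblePartitionOf G 2 (V (suc (suc (suc zero)))) W →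
    FeasiblePartitionOf G 4 ⊤
      (lookup (V (inject₁ i) ∪ V (inject₁ j) ∷ V (inject₁ h) ∷ W zero ∷ W (suc zero) ∷ []))
    × Better (lookup (V (inject₁ i) ∪ V (inject₁ j) ∷ V (inject₁ h) ∷ W zero ∷ W (suc zero) ∷ [])) V
lemma5 G _ V V-feasible V₀≤V₁ V₁≤V₂ _ _ i j h i≢j ijh-sum adjacent small W W-feasible =
  feasible ,
  better-criterion Merged V (suc zero) (suc (suc zero)) (fromℕ 3) (λ ()) (≤V₂ h) (smaller-than-V₃ small)
  where
    open MergeAndSplit G V V-feasible i j h (enumerates i j h i≢j ijh-sum) adjacent W W-feasible

    ≤V₂ : ∀ x → ∣ V (inject₁ x) ∣ ≤ ∣ V (suc (suc zero)) ∣
    ≤V₂ zero = ≤-trans V₀≤V₁ V₁≤V₂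
    ≤V₂ (suc zero) = V₁≤V₂
    ≤V₂ (suc (suc zero)) = ≤-refl
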